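{- Let $n>2$ be an integer. Then: (1) if there exists an admissible graph of order $n$ with $e$ edges, then every vertex of such a graph has degree at least $e-g(n-1)$; (2) $g(n)\le \left\lfloor \dfrac{n\, g(n-1)}{n-2}\right\rfloor$.
   Context: A finite simple graph is admissible if its vertices can be labeled with pairwise distinct integers such that for every edge the sum of the labels of its two endpoints is a power of $2$ (an integer $2^k$ with $k\ge0$). For a positive integer $m$, $g(m)$ is the maximum number of edges of an admissible graph on $m$ vertices; equivalently, the maximum over $m$-element sets $A\subset\mathbb{Z}$ of the number of $2$-element subsets of $A$ whose sum is a power of $2$. -}

module Defs where

open import Data.Nat using (ℕ; _^_; _≤_; _<ᵇ_)
open import Data.Integer using (ℤ; +_) renaming (_+_ to _+ℤ_)
open import Data.Fin using (Fin; toℕ)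
open import Data.List using (map; allFin)
open import Data.Nat.ListAction using (sum)
open import Data.Bool using (Bool; true; false; if_then_else_; _∧_)
open import Data.Product using (Σ; ∃; _×_)
open import Relation.Binary.PropositionalEquality using (_≡_)
open import Function.Definitions using (Injective)

IsPow2 : ℤ → Set
IsPow2 z = ∃ λ (k : ℕ) → z ≡ + (2 ^ k)

record Graph (n : ℕ) : Set where
  field
    adj    : Fin n → Fin n → Bool
    sym    : ∀ i j → adj i j ≡ adj j i
    irrefl : ∀ i → adj i i ≡ false
open Graph public

degree : ∀ {n} → Graph n → Fin n → ℕ
degree G i = sum (map (λ j → if adj G i j then 1 else 0) (allFin _))

edges : ∀ {n} → Graph n → ℕ
edges G = sum (map (λ i → sum (map (λ j → if (toℕ i <ᵇ toℕ j) ∧ adj G i j then 1 else 0) (allFin _))) (allFin _))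

Admissible : ∀ {n} → Graph n → Set
Admissible {n} G = Σ (Fin n → ℤ) λ f → Injective _≡_ _≡_ f × (∀ i j → adj G i j ≡ true → IsPow2 (f i +ℤ f j))

-- IsG m v  :  g(m) = v, i.e. v is the maximum number of edges of an admissible graph on m vertices
IsG : ℕ → ℕ → Set
IsG m v = (Σ (Graph m) λ G → Admissible G × edges G ≡ v) × (∀ (G : Graph m) → Admissible G → edges G ≤ v)

{-# OPTIONS --safe #-}
module Submission where

-- Deleting a vertex v of an admissible graph G on n vertices leaves an admissible
-- graph on n - 1 vertices, and e(G) = deg v + e(G - v) ≤ deg v + g(n-1), which is (1).
-- Summing (1) over all n vertices and using the handshake lemma gives
-- n (e(G) - g(n-1)) ≤ 2 e(G); for e(G) = g(n) this rearranges to (n-2) g(n) ≤ n g(n-1).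

open import Defs renaming (sym to adj-sym)
open import Data.Bool using (Bool; true; false; if_then_else_; _∧_)
open import Data.Bool.Properties using (∧-zeroʳ; ∧-identityʳ)
open import Data.Fin using (Fin; toℕ; punchIn) renaming (zero to fzero; suc to fsuc)
open import Data.Fin.Properties using (toℕ-injective; punchIn-injective)
open import Data.List using (map; allFin; tabulate; _∷_; [])
open import Data.List.Properties using (map-tabulate)
open import Data.Nat using (ℕ; zero; suc; _+_; _*_; _∸_; _≤_; _/_; _<ᵇ_; z≤n; NonZero)
open import Data.Nat.DivMod using (m*n/n≡m; /-monoˡ-≤)
open import Data.Nat.ListAction using () renaming (sum to sumᴸ)
open import Data.Nat.Properties
open import Data.Nat.Tactic.RingSolver using (solve)
open import Data.Product using (_×_; _,_)
open import Data.Sum using (inj₁; inj₂)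
open import Function using (_∘_; id)
open import Relation.Binary.PropositionalEquality
open import Relation.Nullary using (contradiction)

open import Algebra.Properties.CommutativeMonoid.Sum +-0-commutativeMonoid
  using (sum-syntax; sum-cong-≗; sum-remove; ∑-distrib-+; ∑-comm)

bit : Bool → ℕ
bit b = if b then 1 else 0

sum-tabulate : ∀ {n} (f : Fin n → ℕ) → sumᴸ (tabulate f) ≡ ∑[ i < n ] f i
sum-tabulate {zero}  f = refl
sum-tabulate {suc n} f = cong (f fzero +_) (sum-tabulate (f ∘ fsuc))

sum-map-allFin : ∀ n (f : Fin n → ℕ) → sumᴸ (map f (allFin n)) ≡ ∑[ i < n ] f i
sum-map-allFin n f = trans (cong sumᴸ (map-tabulate id f)) (sum-tabulate f)

pointwise-≤⇒*≤∑ : ∀ {n d} {f : Fin n → ℕ} → (∀ i → d ≤ f i) → n * d ≤ ∑[ i < n ] f i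
pointwise-≤⇒*≤∑ {zero}  d≤f = z≤n
pointwise-≤⇒*≤∑ {suc n} d≤f = +-mono-≤ (d≤f fzero) (pointwise-≤⇒*≤∑ (d≤f ∘ fsuc))

bit-<ᵇ-exclusive : ∀ m n → m ≢ n → bit (m <ᵇ n) + bit (n <ᵇ m) ≡ 1
bit-<ᵇ-exclusive zero    zero    m≢n = contradiction refl m≢n
bit-<ᵇ-exclusive zero    (suc n) m≢n = refl
bit-<ᵇ-exclusive (suc m) zero    m≢n = refl
bit-<ᵇ-exclusive (suc m) (suc n) m≢n = bit-<ᵇ-exclusive m n (m≢n ∘ cong suc)

m*n≤o⇒m≤o/n : ∀ m n {o} .{{_ : NonZero n}} → m * n ≤ o → m ≤ o / n
m*n≤o⇒m≤o/n m n {o} m*n≤o = subst (_≤ o / n) (m*n/n≡m m n) (/-monoˡ-≤ n m*n≤o)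

[2+m]*[a∸b]≤2*a⇒m*a≤[2+m]*b : ∀ m a b → (2 + m) * (a ∸ b) ≤ 2 * a → m * a ≤ (2 + m) * b
[2+m]*[a∸b]≤2*a⇒m*a≤[2+m]*b m a b hyp with ≤-total a b
... | inj₁ a≤b = ≤-trans (*-monoʳ-≤ m a≤b) (≤-trans (m≤n+m (m * b) b) (m≤n+m (b + m * b) b))
... | inj₂ b≤a = begin
    m * a              ≡⟨ cong (m *_) b+c≡a ⟨
    m * (b + c)        ≡⟨ *-distribˡ-+ m b c ⟩
    m * b + m * c      ≤⟨ +-monoʳ-≤ (m * b) m*c≤2*b ⟩
    m * b + 2 * b      ≡⟨ solve (m ∷ b ∷ []) ⟩
    (2 + m) * b        ∎
  where
  open ≤-Reasoning
  c : ℕ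
  c = a ∸ b
  b+c≡a : b + c ≡ a
  b+c≡a = m+[n∸m]≡n b≤a
  m*c≤2*b : m * c ≤ 2 * b
  m*c≤2*b = +-cancelˡ-≤ (2 * c) _ _ (begin
    2 * c + m * c      ≡⟨ *-distribʳ-+ c 2 m ⟨
    (2 + m) * c        ≤⟨ hyp ⟩
    2 * a              ≡⟨ cong (2 *_) b+c≡a ⟨
    2 * (b + c)        ≡⟨ trans (*-distribˡ-+ 2 b c) (+-comm (2 * b) (2 * c)) ⟩
    2 * c + 2 * b      ∎)

degree≡∑ : ∀ {n} (G : Graph n) i → degree G i ≡ ∑[ j < n ] bit (adj G i j)
degree≡∑ {n} G i = sum-map-allFin n (bit ∘ adj G i)

edges≡∑ : ∀ {n} (G : Graph n) →
          edges G ≡ ∑[ i < n ] ∑[ j < n ] bit ((toℕ i <ᵇ toℕ j) ∧ adj G i j)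
edges≡∑ {n} G = trans (sum-map-allFin n _) (sum-cong-≗ {n} (λ i → sum-map-allFin n _))

bit-adj-split : ∀ {n} (G : Graph n) i j →
                bit (adj G i j) ≡ bit ((toℕ i <ᵇ toℕ j) ∧ adj G i j) + bit ((toℕ j <ᵇ toℕ i) ∧ adj G i j)
bit-adj-split G i j with adj G i j in i~j
... | false rewrite ∧-zeroʳ (toℕ i <ᵇ toℕ j) | ∧-zeroʳ (toℕ j <ᵇ toℕ i) = refl
... | true  rewrite ∧-identityʳ (toℕ i <ᵇ toℕ j) | ∧-identityʳ (toℕ j <ᵇ toℕ i) =
  sym (bit-<ᵇ-exclusive (toℕ i) (toℕ j) (i≢j ∘ toℕ-injective))
  where
  i≢j : i ≢ j
  i≢j refl with () ← trans (sym i~j) (irrefl G i)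

handshake : ∀ {n} (G : Graph n) → ∑[ i < n ] degree G i ≡ 2 * edges G
handshake {n} G = begin
  ∑[ i < n ] degree G i
    ≡⟨ sum-cong-≗ {n} (λ i → trans (degree≡∑ G i) (sum-cong-≗ {n} (bit-adj-split G i))) ⟩
  ∑[ i < n ] (∑[ j < n ] (forward i j + backward i j))
    ≡⟨ sum-cong-≗ {n} (λ i → ∑-distrib-+ (forward i) (backward i)) ⟩
  ∑[ i < n ] (∑[ j < n ] forward i j + ∑[ j < n ] backward i j)
    ≡⟨ ∑-distrib-+ (λ i → ∑[ j < n ] forward i j) (λ i → ∑[ j < n ] backward i j) ⟩
  E + ∑[ i < n ] ∑[ j < n ] backward i j
    ≡⟨ cong (E +_) (∑-comm backward) ⟩
  E + ∑[ j < n ] ∑[ i < n ] backward i j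
    ≡⟨ cong (E +_) (sum-cong-≗ {n} (λ j → sum-cong-≗ {n} (λ i → cong (bit ∘ ((toℕ j <ᵇ toℕ i) ∧_)) (adj-sym G i j)))) ⟩
  E + E
    ≡⟨ cong (E +_) (+-identityʳ E) ⟨
  2 * E
    ≡⟨ cong (2 *_) (edges≡∑ G) ⟨
  2 * edges G ∎
  where
  open ≡-Reasoning
  forward backward : Fin n → Fin n → ℕ
  forward  i j = bit ((toℕ i <ᵇ toℕ j) ∧ adj G i j)
  backward i j = bit ((toℕ j <ᵇ toℕ i) ∧ adj G i j)
  E : ℕ
  E = ∑[ i < n ] ∑[ j < n ] forward i j

deleteVertex : ∀ {m} → Graph (suc m) → Fin (suc m) → Graph m
deleteVertex G v = record
  { adj    = λ i j → adj G (punchIn v i) (punchIn v j)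
  ; sym    = λ i j → adj-sym G (punchIn v i) (punchIn v j)
  ; irrefl = λ i → irrefl G (punchIn v i)
  }

deleteVertex-admissible : ∀ {m} (G : Graph (suc m)) v → Admissible G → Admissible (deleteVertex G v)
deleteVertex-admissible G v (f , f-injective , f-pow2) =
  f ∘ punchIn v , punchIn-injective v _ _ ∘ f-injective , λ i j → f-pow2 (punchIn v i) (punchIn v j)

degree≡∑-punchIn : ∀ {m} (G : Graph (suc m)) v → degree G v ≡ ∑[ i < m ] bit (adj G v (punchIn v i))
degree≡∑-punchIn G v = begin
  degree G v                                                ≡⟨ degree≡∑ G v ⟩
  ∑[ j < _ ] bit (adj G v j)                                ≡⟨ sum-remove (bit ∘ adj G v) ⟩
  bit (adj G v v) + ∑[ i < _ ] bit (adj G v (punchIn v i))  ≡⟨ cong (λ b → bit b + ∑[ i < _ ] bit (adj G v (punchIn v i))) (irrefl G v) ⟩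
  ∑[ i < _ ] bit (adj G v (punchIn v i))                    ∎
  where open ≡-Reasoning

degree-punchIn : ∀ {m} (G : Graph (suc m)) v i →
                 degree G (punchIn v i) ≡ bit (adj G v (punchIn v i)) + degree (deleteVertex G v) i
degree-punchIn G v i = begin
  degree G (punchIn v i)                                               ≡⟨ degree≡∑ G (punchIn v i) ⟩
  ∑[ j < _ ] bit (adj G (punchIn v i) j)                               ≡⟨ sum-remove (bit ∘ adj G (punchIn v i)) ⟩
  bit (adj G (punchIn v i) v) + ∑[ j < _ ] bit (adj G (punchIn v i) (punchIn v j))
    ≡⟨ cong₂ _+_ (cong bit (adj-sym G (punchIn v i) v)) (sym (degree≡∑ (deleteVertex G v) i)) ⟩
  bit (adj G v (punchIn v i)) + degree (deleteVertex G v) i             ∎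
  where open ≡-Reasoning

∑-degree-deleteVertex : ∀ {m} (G : Graph (suc m)) v →
  ∑[ i < suc m ] degree G i ≡ degree G v + (degree G v + ∑[ i < m ] degree (deleteVertex G v) i)
∑-degree-deleteVertex {m} G v = begin
  ∑[ i < suc m ] degree G i
    ≡⟨ sum-remove (degree G) ⟩
  degree G v + ∑[ i < m ] degree G (punchIn v i)
    ≡⟨ cong (degree G v +_) (sum-cong-≗ {m} (degree-punchIn G v)) ⟩
  degree G v + ∑[ i < m ] (bit (adj G v (punchIn v i)) + degree (deleteVertex G v) i)
    ≡⟨ cong (degree G v +_) (∑-distrib-+ (bit ∘ adj G v ∘ punchIn v) (degree (deleteVertex G v))) ⟩
  degree G v + (∑[ i < m ] bit (adj G v (punchIn v i)) + ∑[ i < m ] degree (deleteVertex G v) i)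
    ≡⟨ cong (λ d → degree G v + (d + ∑[ i < m ] degree (deleteVertex G v) i)) (degree≡∑-punchIn G v) ⟨
  degree G v + (degree G v + ∑[ i < m ] degree (deleteVertex G v) i) ∎
  where open ≡-Reasoning

edges-deleteVertex : ∀ {m} (G : Graph (suc m)) v → edges G ≡ degree G v + edges (deleteVertex G v)
edges-deleteVertex G v = *-cancelˡ-≡ _ _ 2 (begin
  2 * edges G                       ≡⟨ handshake G ⟨
  ∑[ i < _ ] degree G i             ≡⟨ ∑-degree-deleteVertex G v ⟩
  d + (d + ∑[ i < _ ] degree G′ i)  ≡⟨ cong (λ s → d + (d + s)) (handshake G′) ⟩
  d + (d + 2 * e′)                  ≡⟨ double-+ d e′ ⟩
  2 * (d + e′)                      ∎)
  where
  open ≡-Reasoning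
  G′ : Graph _
  G′ = deleteVertex G v
  d e′ : ℕ
  d = degree G v
  e′ = edges G′
  double-+ : ∀ x y → x + (x + 2 * y) ≡ 2 * (x + y)
  double-+ x y = solve (x ∷ y ∷ [])

edges∸bound≤degree : ∀ {m b} → (∀ (H : Graph m) → Admissible H → edges H ≤ b) →
                     ∀ (G : Graph (suc m)) → Admissible G → ∀ v → edges G ∸ b ≤ degree G v
edges∸bound≤degree {b = b} bound G adm v = m≤n+o⇒m∸n≤o (edges G) b (begin
  edges G                                ≡⟨ edges-deleteVertex G v ⟩
  degree G v + edges (deleteVertex G v)  ≤⟨ +-monoʳ-≤ (degree G v) (bound (deleteVertex G v) (deleteVertex-admissible G v adm)) ⟩
  degree G v + b                         ≡⟨ +-comm (degree G v) b ⟩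
  b + degree G v                         ∎)
  where open ≤-Reasoning

minDegree≤⇒*≤2*edges : ∀ {n d} (G : Graph n) → (∀ v → d ≤ degree G v) → n * d ≤ 2 * edges G
minDegree≤⇒*≤2*edges G d≤degree = ≤-trans (pointwise-≤⇒*≤∑ d≤degree) (≤-reflexive (handshake G))

g-recurrence : ∀ {m a b} → IsG (2 + m) a → IsG (suc m) b → m * a ≤ (2 + m) * b
g-recurrence {m} {b = b} ((G , adm , refl) , _) (_ , bound) =
  [2+m]*[a∸b]≤2*a⇒m*a≤[2+m]*b m (edges G) b (minDegree≤⇒*≤2*edges G (edges∸bound≤degree bound G adm))

theorem3 : ∀ (k : ℕ) →
    ((∀ (b : ℕ) → IsG (2 + k) b → ∀ (G : Graph (3 + k)) → Admissible G → ∀ (v : Fin (3 + k)) → edges G ∸ b ≤ degree G v)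
    × (∀ (a b : ℕ) → IsG (3 + k) a → IsG (2 + k) b → a ≤ ((3 + k) * b) / suc k))
theorem3 k =
  (λ b (_ , bound) → edges∸bound≤degree bound) ,
  (λ a b ga gb → m*n≤o⇒m≤o/n a (suc k) (subst (_≤ (3 + k) * b) (*-comm (suc k) a) (g-recurrence ga gb)))
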